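{- Let $a_1,\dots,a_n$ be positive integers and let $K_{a_1,\dots,a_n}$ be the complete $n$-partite graph whose parts have sizes $a_1,\dots,a_n$. Then the nim-value of $K_{a_1,\dots,a_n}$ in graph chomp equals the residue of $p$ modulo $3$, where $p$ is the number of indices $i$ for which $a_i$ is odd.
   Context: The complete $n$-partite graph $K_{a_1,\dots,a_n}$ has its vertex set partitioned into $n$ parts of sizes $a_1,\dots,a_n$, with two vertices adjacent if and only if they lie in different parts. Graph chomp is played on a finite simple graph: two players alternate, and a move consists either of deleting one edge, or of deleting one vertex together with all edges incident to it. The player who makes the last move wins. The nim-value $g$ of a position is defined recursively: the empty graph has nim-value $0$, and $g(G)$ is the minimal nonnegative integer not equal to the nim-value of any position reachable from $G$ in one move. -}

module Defs where

open import Data.Nat using (ℕ; zero; suc; _+_; _<_; _%_; _≟_; s≤s)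
open import Data.Nat.Properties using (≤-refl; +-mono-<-≤; +-monoʳ-<)
open import Data.Nat.Induction using (<-wellFounded)
open import Data.List using (List; []; _∷_; map; _++_; length; filter; concat; upTo)
open import Data.List.Properties using (length-filter)
open import Data.Product using (Σ; _×_; _,_; proj₁; proj₂)
open import Data.Product.Properties using (≡-dec)
open import Data.Sum using (_⊎_)
open import Relation.Nullary.Decidable using (_⊎-dec_)
open import Data.Bool using (Bool; true; false; if_then_else_)
open import Relation.Nullary using (¬_; ¬?; does; Dec)
open import Relation.Binary.PropositionalEquality using (_≡_)
open import Induction.WellFounded using (Acc; acc)

-- A vertex is a label in ℕ × ℕ; a graph is a list of (distinct) vertices
-- together with a list of edges, each (unordered, loop-free) edge listed
-- exactly once as a pair of vertices of the graph.  All positions arising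
-- below (from complete multipartite graphs by chomp moves) have this form.

Vertex : Set
Vertex = ℕ × ℕ

Edge : Set
Edge = Vertex × Vertex

record Graph : Set where
  constructor graph
  field
    vertices : List Vertex
    edges    : List Edge
open Graph public

_≟ᵥ_ : (u v : Vertex) → Dec (u ≡ v)
_≟ᵥ_ = ≡-dec _≟_ _≟_

Incident : Vertex → Edge → Set
Incident x (u , v) = (u ≡ x) ⊎ (v ≡ x)

incident? : (x : Vertex) (e : Edge) → Dec (Incident x e)
incident? x (u , v) = (u ≟ᵥ x) ⊎-dec (v ≟ᵥ x)

size : Graph → ℕ
size G = length (vertices G) + length (edges G)

picks : {A : Set} (xs : List A) →
        List (Σ (A × List A) (λ p → length (proj₂ p) < length xs))
picks [] = []
picks (x ∷ xs) =
  ((x , xs) , ≤-refl) ∷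
  map (λ { ((y , r) , p) → ((y , x ∷ r) , s≤s p) }) (picks xs)

_∈ᵇ_ : ℕ → List ℕ → Bool
k ∈ᵇ [] = false
k ∈ᵇ (x ∷ xs) = if does (k ≟ x) then true else (k ∈ᵇ xs)

mexSearch : List ℕ → ℕ → ℕ → ℕ
mexSearch xs k zero = k
mexSearch xs k (suc f) = if k ∈ᵇ xs then mexSearch xs (suc k) f else k

-- mex xs = least natural number not in xs (it is ≤ length xs)
mex : List ℕ → ℕ
mex xs = mexSearch xs 0 (length xs)

nimAcc : (G : Graph) → Acc _<_ (size G) → ℕ
nimAcc (graph vs es) (acc rs) =
  mex ( map (λ { ((x , rest) , p) →
                   nimAcc (graph rest (filter (λ e → ¬? (incident? x e)) es))
                          (rs (+-mono-<-≤ p (length-filter (λ e → ¬? (incident? x e)) es))) })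
            (picks vs)
      ++ map (λ { ((e , rest) , p) →
                   nimAcc (graph vs rest) (rs (+-monoʳ-< (length vs) p)) })
            (picks es))

nimValue : Graph → ℕ
nimValue G = nimAcc G (<-wellFounded (size G))

-- Complete multipartite graph K_{a_1,…,a_n} for as = a_1 ∷ … ∷ a_n ∷ [].
-- Vertex (i , j) is the j-th vertex (j < a_{i+1}) of the (i+1)-th part.

partVertices : ℕ → List ℕ → List Vertex
partVertices i [] = []
partVertices i (a ∷ as) = map (λ j → (i , j)) (upTo a) ++ partVertices (suc i) as

orderedPairs : {A : Set} → List A → List (A × A)
orderedPairs [] = []
orderedPairs (x ∷ xs) = map (λ y → (x , y)) xs ++ orderedPairs xs

completeMultipartite : List ℕ → Graph
completeMultipartite as =
  graph vs (filter (λ e → ¬? (proj₁ (proj₁ e) ≟ proj₁ (proj₂ e))) (orderedPairs vs))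
  where vs = partVertices 0 as

numOdd : List ℕ → ℕ
numOdd as = length (filter (λ a → a % 2 ≟ 1) as)

-- Let σ reflect every part of K_{a₁,…,aₙ} onto itself.  It is an involutive automorphism
-- joining no vertex to its image, and its fixed vertices (the middle vertex of every odd
-- part) span a complete graph K_p.  For any such pair (G, σ) the mirror strategy gives
-- g(G) = g(G^σ): a move inside the fixed subgraph G^σ is copied there, and any other move
-- is answered by its σ-image.  Finally g(K_p) = p mod 3 by induction on p: deleting a
-- vertex leaves K_{p-1}, and deleting an edge ab leaves a graph whose fixed subgraph under
-- the transposition of a and b is K_{p-2}.

module Submission where

open import Defs
open import Data.Nat using (ℕ; zero; suc; _+_; _≡ᵇ_; ⌊_/2⌋; _∸_; _<_; _≤_; _%_; s≤s; z≤n)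
open import Data.Nat.Properties
open import Data.Nat.DivMod using ([m+n]%n≡m%n)
open import Data.Nat.Induction using (<-wellFounded)
open import Data.List using (List; []; _∷_; map; _++_; length; filter; upTo)
open import Data.List.Properties using (map-++; map-cong; map-∘; filter-notAll; length-filter; filter-accept; filter-reject)
open import Data.List.Membership.Propositional using (_∈_; _∉_)
open import Data.List.Membership.Propositional.Properties
open import Data.List.Relation.Unary.Any using (Any; here; there)
import Data.List.Relation.Unary.All as All
open All using (All)
open import Data.List.Relation.Unary.AllPairs using (AllPairs; []; _∷_)
import Data.List.Relation.Unary.Unique.Propositional.Properties as Unique
import Data.List.Relation.Unary.AllPairs.Properties as AllPairs
open import Data.Product using (Σ; _×_; _,_; proj₁; proj₂)
open import Data.Sum using (_⊎_; inj₁; inj₂; map₂; [_,_]′) renaming (map to map-⊎)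
open import Data.Bool using (true; false)
open import Data.Maybe using (Maybe; just; nothing)
import Data.Maybe as Maybe
open import Data.Empty using (⊥-elim)
open import Relation.Nullary using (¬_; ¬?; Dec; yes; no)
open import Relation.Binary.Definitions using (Symmetric; tri<; tri≈; tri>)
open import Relation.Binary.PropositionalEquality
open import Function using (_∘_; id)
open import Induction.WellFounded using (Acc; acc)

-- Minimum excluded value

∈ᵇ-true⇒∈ : ∀ k xs → k ∈ᵇ xs ≡ true → k ∈ xs
∈ᵇ-true⇒∈ k (x ∷ xs) eq with k ≡ᵇ x | ≡ᵇ⇒≡ k x
... | true  | sound = here (sound _)
... | false | _     = there (∈ᵇ-true⇒∈ k xs eq)

∈ᵇ-false⇒∉ : ∀ k xs → k ∈ᵇ xs ≡ false → k ∉ xs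
∈ᵇ-false⇒∉ k (x ∷ xs) eq k∈ with k ≡ᵇ x | ≡⇒≡ᵇ k x | k∈
... | false | complete | here k≡x   = complete k≡x
... | false | _        | there k∈xs = ∈ᵇ-false⇒∉ k xs eq k∈xs

record MexSearchSpec (xs : List ℕ) (k f r : ℕ) : Set where
  field
    k≤r     : k ≤ r
    skipped : ∀ j → k ≤ j → j < r → j ∈ xs
    stopped : r ∉ xs ⊎ r ≡ k + f

mexSearch-spec : ∀ xs k f → MexSearchSpec xs k f (mexSearch xs k f)
mexSearch-spec xs k zero = record
  { k≤r = ≤-refl ; skipped = λ j k≤j j<k → ⊥-elim (≤⇒≯ k≤j j<k) ; stopped = inj₂ (sym (+-identityʳ k)) }
mexSearch-spec xs k (suc f) with k ∈ᵇ xs in eq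
... | false = record
  { k≤r = ≤-refl ; skipped = λ j k≤j j<k → ⊥-elim (≤⇒≯ k≤j j<k) ; stopped = inj₁ (∈ᵇ-false⇒∉ k xs eq) }
... | true = record
  { k≤r = ≤-trans (n≤1+n k) k≤r
  ; skipped = skipped′
  ; stopped = map₂ (λ r≡ → trans r≡ (sym (+-suc k f))) stopped }
  where
  open MexSearchSpec (mexSearch-spec xs (suc k) f)
  skipped′ : ∀ j → k ≤ j → j < mexSearch xs (suc k) f → j ∈ xs
  skipped′ j k≤j j<r with k ≟ j
  ... | yes refl = ∈ᵇ-true⇒∈ k xs eq
  ... | no k≢j = skipped j (≤∧≢⇒< k≤j k≢j) j<r

covers⇒≤length : ∀ n xs → (∀ j → j < n → j ∈ xs) → n ≤ length xs
covers⇒≤length zero xs covers = z≤n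
covers⇒≤length (suc m) xs covers =
  ≤-trans (s≤s (covers⇒≤length m others covers-others)) (filter-notAll (λ y → ¬? (y ≟ m)) xs (contains-m (covers m ≤-refl)))
  where
  others = filter (λ y → ¬? (y ≟ m)) xs
  covers-others : ∀ j → j < m → j ∈ others
  covers-others j j<m = ∈-filter⁺ (λ y → ¬? (y ≟ m)) (covers j (m<n⇒m<1+n j<m)) (<⇒≢ j<m)
  contains-m : ∀ {zs} → m ∈ zs → Any (λ y → ¬ ¬ (y ≡ m)) zs
  contains-m (here refl) = here (λ y≢m → y≢m refl)
  contains-m (there m∈) = there (contains-m m∈)

<mex⇒∈ : ∀ xs j → j < mex xs → j ∈ xs
<mex⇒∈ xs j = MexSearchSpec.skipped (mexSearch-spec xs 0 (length xs)) j z≤n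

mex∉ : ∀ xs → mex xs ∉ xs
mex∉ xs with MexSearchSpec.stopped (mexSearch-spec xs 0 (length xs))
... | inj₁ mex∉xs = mex∉xs
... | inj₂ mex≡length = λ mex∈ → <-irrefl refl (covers⇒≤length (suc (length xs)) xs (covers mex∈))
  where
  -- if the search ran out of fuel and found nothing, xs contains 0, …, length xs
  covers : mex xs ∈ xs → ∀ j → j < suc (length xs) → j ∈ xs
  covers mex∈ j j<1+len with j ≟ length xs
  ... | yes refl = subst (_∈ xs) mex≡length mex∈
  ... | no j≢len = <mex⇒∈ xs j (subst (j <_) (sym mex≡length) (≤∧≢⇒< (≤-pred j<1+len) j≢len))

mex-unique : ∀ xs k → k ∉ xs → (∀ j → j < k → j ∈ xs) → mex xs ≡ k
mex-unique xs k k∉ below with <-cmp (mex xs) k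
... | tri< mex<k _ _ = ⊥-elim (mex∉ xs (below (mex xs) mex<k))
... | tri≈ _ mex≡k _ = mex≡k
... | tri> _ _ k<mex = ⊥-elim (k∉ (<mex⇒∈ xs k k<mex))

-- Chomp moves

deleteVertex : Vertex → List Vertex → List Edge → Graph
deleteVertex x rest es = graph rest (filter (λ e → ¬? (incident? x e)) es)

Picked : Set → ℕ → Set
Picked A n = Σ (A × List A) (λ p → length (proj₂ p) < n)

vertexOption : ∀ {n} → List Edge → Picked Vertex n → Graph
vertexOption es ((x , rest) , _) = deleteVertex x rest es

edgeOption : ∀ {n} → List Vertex → Picked Edge n → Graph
edgeOption vs ((_ , rest) , _) = graph vs rest

options : Graph → List Graph
options (graph vs es) = map (vertexOption es) (picks vs) ++ map (edgeOption vs) (picks es)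

nimAcc-irrelevant : ∀ G (a b : Acc _<_ (size G)) → nimAcc G a ≡ nimAcc G b
nimAcc-irrelevant (graph vs es) (acc rs) (acc rs′) = cong mex (cong₂ _++_
  (map-cong (λ p → nimAcc-irrelevant (vertexOption es p) (rs _) (rs′ _)) (picks vs))
  (map-cong (λ p → nimAcc-irrelevant (edgeOption vs p) (rs _) (rs′ _)) (picks es)))

nimAcc-options : ∀ G (a : Acc _<_ (size G)) → nimAcc G a ≡ mex (map nimValue (options G))
nimAcc-options G@(graph vs es) a@(acc rs) = begin
  nimAcc G a
    ≡⟨ cong mex (cong₂ _++_
         (map-cong (λ p → nimAcc-irrelevant (vertexOption es p) (rs _) (<-wellFounded _)) (picks vs))
         (map-cong (λ p → nimAcc-irrelevant (edgeOption vs p) (rs _) (<-wellFounded _)) (picks es))) ⟩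
  mex (map (nimValue ∘ vertexOption es) (picks vs) ++ map (nimValue ∘ edgeOption vs) (picks es))
    ≡⟨ cong mex (cong₂ _++_ (map-∘ (picks vs)) (map-∘ (picks es))) ⟩
  mex (map nimValue (map (vertexOption es) (picks vs)) ++ map nimValue (map (edgeOption vs) (picks es)))
    ≡⟨ cong mex (map-++ nimValue (map (vertexOption es) (picks vs)) _) ⟨
  mex (map nimValue (options G)) ∎
  where open ≡-Reasoning

nimValue-options : ∀ G → nimValue G ≡ mex (map nimValue (options G))
nimValue-options G = nimAcc-options G (<-wellFounded (size G))

nimValue≡-from-options : ∀ G k → (∀ O → O ∈ options G → nimValue O ≢ k) →
                         (∀ j → j < k → Σ Graph λ O → O ∈ options G × nimValue O ≡ j) →
                         nimValue G ≡ k
nimValue≡-from-options G k avoids reaches = trans (nimValue-options G) (mex-unique _ k k∉ below)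
  where
  k∉ : k ∉ map nimValue (options G)
  k∉ k∈ with O , O∈ , k≡ ← ∈-map⁻ nimValue k∈ = avoids O O∈ (sym k≡)
  below : ∀ j → j < k → j ∈ map nimValue (options G)
  below j j<k with O , O∈ , refl ← reaches j j<k = ∈-map⁺ nimValue O∈

option-nimValue≢ : ∀ G O → O ∈ options G → nimValue O ≢ nimValue G
option-nimValue≢ G O O∈ O≡G = mex∉ (map nimValue (options G))
  (subst (_∈ map nimValue (options G)) (trans O≡G (nimValue-options G)) (∈-map⁺ nimValue O∈))

<nimValue⇒option : ∀ G j → j < nimValue G → Σ Graph λ O → O ∈ options G × nimValue O ≡ j
<nimValue⇒option G j j<
  with O , O∈ , j≡ ← ∈-map⁻ nimValue (<mex⇒∈ _ j (subst (j <_) (nimValue-options G) j<)) = O , O∈ , sym j≡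

data Pick {A : Set} : List A → A → List A → Set where
  here  : ∀ {x xs} → Pick (x ∷ xs) x xs
  there : ∀ {x xs y rest} → Pick xs y rest → Pick (x ∷ xs) y (x ∷ rest)

∈picks⇒Pick : ∀ {A : Set} {xs : List A} {p : Picked A (length xs)} → p ∈ picks xs →
              Pick xs (proj₁ (proj₁ p)) (proj₂ (proj₁ p))
∈picks⇒Pick {xs = x ∷ xs} (here refl) = here
∈picks⇒Pick {xs = x ∷ xs} (there p∈) with _ , q∈ , refl ← ∈-map⁻ _ p∈ = there (∈picks⇒Pick q∈)

Pick⇒∈picks : ∀ {A : Set} {xs : List A} {y rest} → Pick xs y rest →
              Σ (Picked A (length xs)) λ p → p ∈ picks xs × proj₁ p ≡ (y , rest)
Pick⇒∈picks here = _ , here refl , refl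
Pick⇒∈picks (there {x = x} pk) with _ , p∈ , refl ← Pick⇒∈picks pk =
  _ , there (∈-map⁺ (λ { ((y , r) , p) → ((y , x ∷ r) , s≤s p) }) p∈) , refl

module _ {A : Set} where

  ∈⇒Pick : ∀ {x : A} {xs} → x ∈ xs → Σ (List A) (Pick xs x)
  ∈⇒Pick (here refl) = _ , here
  ∈⇒Pick (there x∈) with _ , pk ← ∈⇒Pick x∈ = _ , there pk

  Pick-length : ∀ {xs : List A} {y rest} → Pick xs y rest → suc (length rest) ≡ length xs
  Pick-length here = refl
  Pick-length (there pk) = cong suc (Pick-length pk)

  Pick⇒∈ : ∀ {xs : List A} {y rest} → Pick xs y rest → y ∈ xs
  Pick⇒∈ here = here refl
  Pick⇒∈ (there pk) = there (Pick⇒∈ pk)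

  Pick-rest⊆ : ∀ {xs : List A} {y rest z} → Pick xs y rest → z ∈ rest → z ∈ xs
  Pick-rest⊆ here z∈ = there z∈
  Pick-rest⊆ (there pk) (here z≡) = here z≡
  Pick-rest⊆ (there pk) (there z∈) = there (Pick-rest⊆ pk z∈)

  Pick-split : ∀ {xs : List A} {y rest z} → Pick xs y rest → z ∈ xs → z ≡ y ⊎ z ∈ rest
  Pick-split here (here z≡) = inj₁ z≡
  Pick-split here (there z∈) = inj₂ z∈
  Pick-split (there pk) (here z≡) = inj₂ (here z≡)
  Pick-split (there pk) (there z∈) = map₂ there (Pick-split pk z∈)

  Pick-AllPairs : ∀ {R : A → A → Set} {xs : List A} {y rest} → Pick xs y rest → AllPairs R xs → AllPairs R rest
  Pick-AllPairs here (_ ∷ rxs) = rxs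
  Pick-AllPairs (there pk) (rx ∷ rxs) = All.tabulate (λ z∈ → All.lookup rx (Pick-rest⊆ pk z∈)) ∷ Pick-AllPairs pk rxs

  Pick-AllPairs-picked : ∀ {R : A → A → Set} → Symmetric R → ∀ {xs : List A} {y rest z} →
                         Pick xs y rest → AllPairs R xs → z ∈ rest → R y z
  Pick-AllPairs-picked sym-R here (ry ∷ _) z∈ = All.lookup ry z∈
  Pick-AllPairs-picked sym-R (there pk) (rx ∷ _) (here refl) = sym-R (All.lookup rx (Pick⇒∈ pk))
  Pick-AllPairs-picked sym-R (there pk) (_ ∷ rxs) (there z∈) = Pick-AllPairs-picked sym-R pk rxs z∈

_≈ₑ_ : Edge → Edge → Set
(u , v) ≈ₑ (a , b) = (u ≡ a × v ≡ b) ⊎ (u ≡ b × v ≡ a)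

≈ₑ-refl : ∀ {e} → e ≈ₑ e
≈ₑ-refl = inj₁ (refl , refl)

≈ₑ-sym : ∀ {e f} → e ≈ₑ f → f ≈ₑ e
≈ₑ-sym (inj₁ (refl , refl)) = inj₁ (refl , refl)
≈ₑ-sym (inj₂ (refl , refl)) = inj₂ (refl , refl)

≈ₑ-trans : ∀ {e f g} → e ≈ₑ f → f ≈ₑ g → e ≈ₑ g
≈ₑ-trans (inj₁ (refl , refl)) q = q
≈ₑ-trans (inj₂ (refl , refl)) (inj₁ (refl , refl)) = inj₂ (refl , refl)
≈ₑ-trans (inj₂ (refl , refl)) (inj₂ (refl , refl)) = inj₁ (refl , refl)

≈ₑ-flip : ∀ {u v e} → (u , v) ≈ₑ e → (v , u) ≈ₑ e
≈ₑ-flip (inj₁ (refl , refl)) = inj₂ (refl , refl)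
≈ₑ-flip (inj₂ (refl , refl)) = inj₁ (refl , refl)

Adj : Graph → Vertex → Vertex → Set
Adj G u v = Σ Edge λ e → e ∈ edges G × (u , v) ≈ₑ e

record WellFormed (G : Graph) : Set where
  field
    distinctVertices : AllPairs _≢_ (vertices G)
    distinctEdges    : AllPairs (λ e f → ¬ e ≈ₑ f) (edges G)
    edgeEnds         : ∀ {u v} → (u , v) ∈ edges G → u ∈ vertices G × v ∈ vertices G × u ≢ v

Adj⇒ends : ∀ {G u v} → WellFormed G → Adj G u v → u ∈ vertices G × v ∈ vertices G × u ≢ v
Adj⇒ends wf (_ , e∈ , inj₁ (refl , refl)) = WellFormed.edgeEnds wf e∈
Adj⇒ends wf (_ , e∈ , inj₂ (refl , refl)) with u∈ , v∈ , u≢v ← WellFormed.edgeEnds wf e∈ = v∈ , u∈ , ≢-sym u≢v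

record IsVertexDeletion (G : Graph) (x : Vertex) (O : Graph) : Set where
  field
    x∈         : x ∈ vertices G
    wellFormed : WellFormed O
    vertex⇒    : ∀ {z} → z ∈ vertices O → z ∈ vertices G × z ≢ x
    vertex⇐    : ∀ {z} → z ∈ vertices G → z ≢ x → z ∈ vertices O
    adj⇒       : ∀ {u v} → Adj O u v → Adj G u v × u ≢ x × v ≢ x
    adj⇐       : ∀ {u v} → Adj G u v → u ≢ x → v ≢ x → Adj O u v
    length≡    : suc (length (vertices O)) ≡ length (vertices G)

record IsEdgeDeletion (G : Graph) (e : Edge) (O : Graph) : Set where
  field
    adjacent   : Adj G (proj₁ e) (proj₂ e)
    wellFormed : WellFormed O
    vertex⇒    : ∀ {z} → z ∈ vertices O → z ∈ vertices G
    vertex⇐    : ∀ {z} → z ∈ vertices G → z ∈ vertices O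
    adj⇒       : ∀ {u v} → Adj O u v → Adj G u v × ¬ (u , v) ≈ₑ e
    adj⇐       : ∀ {u v} → Adj G u v → ¬ (u , v) ≈ₑ e → Adj O u v

deleteVertex-isVertexDeletion : ∀ {G x rest} → WellFormed G → Pick (vertices G) x rest →
                                IsVertexDeletion G x (deleteVertex x rest (edges G))
deleteVertex-isVertexDeletion {graph vs es} {x} {rest} wf pk = record
  { x∈ = Pick⇒∈ pk
  ; wellFormed = record
    { distinctVertices = Pick-AllPairs pk distinctVertices
    ; distinctEdges = AllPairs.filter⁺ _ distinctEdges
    ; edgeEnds = edgeEnds′ }
  ; vertex⇒ = λ z∈ → Pick-rest⊆ pk z∈ , ≢-sym (Pick-AllPairs-picked ≢-sym pk distinctVertices z∈)
  ; vertex⇐ = vertex⇐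
  ; adj⇒ = adj⇒
  ; adj⇐ = adj⇐
  ; length≡ = Pick-length pk }
  where
  open WellFormed wf
  avoids-x = λ e → ¬? (incident? x e)
  vertex⇐ : ∀ {z} → z ∈ vs → z ≢ x → z ∈ rest
  vertex⇐ z∈ z≢x with Pick-split pk z∈
  ... | inj₁ z≡x = ⊥-elim (z≢x z≡x)
  ... | inj₂ z∈rest = z∈rest
  edgeEnds′ : ∀ {u v} → (u , v) ∈ filter avoids-x es → u ∈ rest × v ∈ rest × u ≢ v
  edgeEnds′ e∈ with e∈es , avoids ← ∈-filter⁻ avoids-x {xs = es} e∈
                 with u∈ , v∈ , u≢v ← edgeEnds e∈es =
    vertex⇐ u∈ (avoids ∘ inj₁) , vertex⇐ v∈ (avoids ∘ inj₂) , u≢v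
  adj⇒ : ∀ {u v} → Adj (deleteVertex x rest es) u v → Adj (graph vs es) u v × u ≢ x × v ≢ x
  adj⇒ (e , e∈ , _) with ∈-filter⁻ avoids-x {xs = es} e∈
  adj⇒ (e , e∈ , inj₁ (refl , refl)) | e∈es , avoids = (e , e∈es , ≈ₑ-refl) , avoids ∘ inj₁ , avoids ∘ inj₂
  adj⇒ (e , e∈ , inj₂ (refl , refl)) | e∈es , avoids = (e , e∈es , inj₂ (refl , refl)) , avoids ∘ inj₂ , avoids ∘ inj₁
  adj⇐ : ∀ {u v} → Adj (graph vs es) u v → u ≢ x → v ≢ x → Adj (deleteVertex x rest es) u v
  adj⇐ (e , e∈ , inj₁ (refl , refl)) u≢x v≢x = e , ∈-filter⁺ avoids-x e∈ [ u≢x , v≢x ]′ , ≈ₑ-refl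
  adj⇐ (e , e∈ , inj₂ (refl , refl)) u≢x v≢x = e , ∈-filter⁺ avoids-x e∈ [ v≢x , u≢x ]′ , inj₂ (refl , refl)

deleteEdge-isEdgeDeletion : ∀ {G e rest} → WellFormed G → Pick (edges G) e rest →
                            IsEdgeDeletion G e (graph (vertices G) rest)
deleteEdge-isEdgeDeletion {graph vs es} {e} {rest} wf pk = record
  { adjacent = e , Pick⇒∈ pk , ≈ₑ-refl
  ; wellFormed = record
    { distinctVertices = distinctVertices
    ; distinctEdges = Pick-AllPairs pk distinctEdges
    ; edgeEnds = edgeEnds ∘ Pick-rest⊆ pk }
  ; vertex⇒ = id
  ; vertex⇐ = id
  ; adj⇒ = λ (f , f∈ , u,v≈f) → (f , Pick-rest⊆ pk f∈ , u,v≈f) ,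
             λ u,v≈e → Pick-AllPairs-picked (λ e≉f f≈e → e≉f (≈ₑ-sym f≈e)) pk distinctEdges f∈
                         (≈ₑ-trans (≈ₑ-sym u,v≈e) u,v≈f)
  ; adj⇐ = adj⇐ }
  where
  open WellFormed wf
  adj⇐ : ∀ {u v} → Adj (graph vs es) u v → ¬ (u , v) ≈ₑ e → Adj (graph vs rest) u v
  adj⇐ (f , f∈ , u,v≈f) u,v≉e with Pick-split pk f∈
  ... | inj₁ refl = ⊥-elim (u,v≉e u,v≈f)
  ... | inj₂ f∈rest = f , f∈rest , u,v≈f

∈options⇒deletion : ∀ G {O} → O ∈ options G →
  (Σ Vertex λ x → Σ (List Vertex) λ rest → Pick (vertices G) x rest × O ≡ deleteVertex x rest (edges G)) ⊎
  (Σ Edge λ e → Σ (List Edge) λ rest → Pick (edges G) e rest × O ≡ graph (vertices G) rest)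
∈options⇒deletion (graph vs es) O∈ with ∈-++⁻ (map (vertexOption es) (picks vs)) O∈
... | inj₁ O∈V with _ , p∈ , refl ← ∈-map⁻ (vertexOption es) O∈V = inj₁ (_ , _ , ∈picks⇒Pick p∈ , refl)
... | inj₂ O∈E with _ , p∈ , refl ← ∈-map⁻ (edgeOption vs) O∈E = inj₂ (_ , _ , ∈picks⇒Pick p∈ , refl)

deleteVertex∈options : ∀ G {x rest} → Pick (vertices G) x rest → deleteVertex x rest (edges G) ∈ options G
deleteVertex∈options (graph vs es) pk with p , p∈ , refl ← Pick⇒∈picks pk =
  ∈-++⁺ˡ (∈-map⁺ (vertexOption es) p∈)

deleteEdge∈options : ∀ G {e rest} → Pick (edges G) e rest → graph (vertices G) rest ∈ options G
deleteEdge∈options (graph vs es) pk with p , p∈ , refl ← Pick⇒∈picks pk =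
  ∈-++⁺ʳ (map (vertexOption es) (picks vs)) (∈-map⁺ (edgeOption vs) p∈)

options-size< : ∀ G {O} → O ∈ options G → size O < size G
options-size< G O∈ with ∈options⇒deletion G O∈
... | inj₁ (x , _ , pk , refl) = +-mono-<-≤ (≤-reflexive (Pick-length pk)) (length-filter (λ e → ¬? (incident? x e)) (edges G))
... | inj₂ (e , _ , pk , refl) = +-monoʳ-< (length (vertices G)) (≤-reflexive (Pick-length pk))

options-deletion : ∀ G {O} → WellFormed G → O ∈ options G →
                   (Σ Vertex λ x → IsVertexDeletion G x O) ⊎ (Σ Edge λ e → IsEdgeDeletion G e O)
options-deletion G wf O∈ with ∈options⇒deletion G O∈
... | inj₁ (x , _ , pk , refl) = inj₁ (x , deleteVertex-isVertexDeletion wf pk)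
... | inj₂ (e , _ , pk , refl) = inj₂ (e , deleteEdge-isEdgeDeletion wf pk)

vertexDeletion∈options : ∀ G {x} → WellFormed G → x ∈ vertices G →
                         Σ Graph λ O → O ∈ options G × IsVertexDeletion G x O
vertexDeletion∈options G wf x∈ with _ , pk ← ∈⇒Pick x∈ =
  _ , deleteVertex∈options G pk , deleteVertex-isVertexDeletion wf pk

IsEdgeDeletion-resp-≈ₑ : ∀ {G e f O} → e ≈ₑ f → IsEdgeDeletion G f O → IsEdgeDeletion G e O
IsEdgeDeletion-resp-≈ₑ e≈f del = record
  { adjacent = let (g , g∈ , f≈g) = adjacent in g , g∈ , ≈ₑ-trans e≈f f≈g
  ; wellFormed = wellFormed ; vertex⇒ = vertex⇒ ; vertex⇐ = vertex⇐
  ; adj⇒ = λ uv → proj₁ (adj⇒ uv) , λ u,v≈e → proj₂ (adj⇒ uv) (≈ₑ-trans u,v≈e e≈f)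
  ; adj⇐ = λ uv u,v≉e → adj⇐ uv (λ u,v≈f → u,v≉e (≈ₑ-trans u,v≈f (≈ₑ-sym e≈f))) }
  where open IsEdgeDeletion del

edgeDeletion∈options : ∀ G {a b} → WellFormed G → Adj G a b →
                       Σ Graph λ O → O ∈ options G × IsEdgeDeletion G (a , b) O
edgeDeletion∈options G wf (f , f∈ , a,b≈f) with _ , pk ← ∈⇒Pick f∈ =
  _ , deleteEdge∈options G pk , IsEdgeDeletion-resp-≈ₑ a,b≈f (deleteEdge-isEdgeDeletion wf pk)

-- The mirror strategy

module Mirror (σ : Vertex → Vertex) (σ-involutive : ∀ z → σ (σ z) ≡ z) where

  Fixed : Vertex → Set
  Fixed z = σ z ≡ z

  record FixedPart (G C : Graph) : Set where
    field
      wellFormedG : WellFormed G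
      wellFormedC : WellFormed C
      σ-vertex    : ∀ {z} → z ∈ vertices G → σ z ∈ vertices G
      σ-adj       : ∀ {u v} → Adj G u v → Adj G (σ u) (σ v)
      ¬adj-σ      : ∀ {u} → ¬ Adj G u (σ u)
      vertexC⇒    : ∀ {z} → z ∈ vertices C → z ∈ vertices G × Fixed z
      vertexC⇐    : ∀ {z} → z ∈ vertices G → Fixed z → z ∈ vertices C
      adjC⇒       : ∀ {u v} → Adj C u v → Adj G u v × Fixed u × Fixed v
      adjC⇐       : ∀ {u v} → Adj G u v → Fixed u → Fixed v → Adj C u v

  σ-transpose : ∀ {a b} → σ a ≡ b → a ≡ σ b
  σ-transpose {a} refl = sym (σ-involutive a)

  σ-injective : ∀ {u v} → σ u ≡ σ v → u ≡ v
  σ-injective {v = v} σu≡σv = trans (σ-transpose σu≡σv) (σ-involutive v)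

  σ≡fixed⇒≡ : ∀ {z x} → Fixed x → σ z ≡ x → z ≡ x
  σ≡fixed⇒≡ fx σz≡x = σ-injective (trans σz≡x (sym fx))

  σ-≈ₑ : ∀ {u v a b} → (σ u , σ v) ≈ₑ (a , b) → (u , v) ≈ₑ (σ a , σ b)
  σ-≈ₑ (inj₁ (p , q)) = inj₁ (σ-transpose p , σ-transpose q)
  σ-≈ₑ (inj₂ (p , q)) = inj₂ (σ-transpose p , σ-transpose q)

  σ-≈ₑ-injective : ∀ {u v a b} → (σ u , σ v) ≈ₑ (σ a , σ b) → (u , v) ≈ₑ (a , b)
  σ-≈ₑ-injective {u} {v} {a} {b} p =
    subst₂ (λ x y → (u , v) ≈ₑ (x , y)) (σ-involutive a) (σ-involutive b) (σ-≈ₑ p)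

  ≈ₑ-Fixed : ∀ {u v p q} → (u , v) ≈ₑ (p , q) → Fixed u → Fixed v → Fixed p × Fixed q
  ≈ₑ-Fixed (inj₁ (refl , refl)) fu fv = fu , fv
  ≈ₑ-Fixed (inj₂ (refl , refl)) fu fv = fv , fu

  FixedPart-deleteFixedVertex : ∀ {G C O C′ x} → FixedPart G C → IsVertexDeletion G x O →
                                IsVertexDeletion C x C′ → Fixed x → FixedPart O C′
  FixedPart-deleteFixedVertex fp del delC fx = record
    { wellFormedG = D.wellFormed ; wellFormedC = DC.wellFormed
    ; σ-vertex = λ z∈ → let (z∈G , z≢x) = D.vertex⇒ z∈ in D.vertex⇐ (σ-vertex z∈G) (z≢x ∘ σ≡fixed⇒≡ fx)
    ; σ-adj = λ uv → let (uvG , u≢x , v≢x) = D.adj⇒ uv in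
        D.adj⇐ (σ-adj uvG) (u≢x ∘ σ≡fixed⇒≡ fx) (v≢x ∘ σ≡fixed⇒≡ fx)
    ; ¬adj-σ = ¬adj-σ ∘ proj₁ ∘ D.adj⇒
    ; vertexC⇒ = λ z∈ → let (z∈C , z≢x) = DC.vertex⇒ z∈ ; (z∈G , fz) = vertexC⇒ z∈C in D.vertex⇐ z∈G z≢x , fz
    ; vertexC⇐ = λ z∈ fz → let (z∈G , z≢x) = D.vertex⇒ z∈ in DC.vertex⇐ (vertexC⇐ z∈G fz) z≢x
    ; adjC⇒ = λ uv → let (uvC , u≢x , v≢x) = DC.adj⇒ uv ; (uvG , fu , fv) = adjC⇒ uvC in
        D.adj⇐ uvG u≢x v≢x , fu , fv
    ; adjC⇐ = λ uv fu fv → let (uvG , u≢x , v≢x) = D.adj⇒ uv in DC.adj⇐ (adjC⇐ uvG fu fv) u≢x v≢x }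
    where
    open FixedPart fp
    module D = IsVertexDeletion del
    module DC = IsVertexDeletion delC

  FixedPart-deleteFixedEdge : ∀ {G C O C′ a b} → FixedPart G C → IsEdgeDeletion G (a , b) O →
                              IsEdgeDeletion C (a , b) C′ → Fixed a → Fixed b → FixedPart O C′
  FixedPart-deleteFixedEdge fp del delC fa fb = record
    { wellFormedG = D.wellFormed ; wellFormedC = DC.wellFormed
    ; σ-vertex = D.vertex⇐ ∘ σ-vertex ∘ D.vertex⇒
    ; σ-adj = λ uv → let (uvG , u,v≉ab) = D.adj⇒ uv in
        D.adj⇐ (σ-adj uvG) (u,v≉ab ∘ subst₂ (λ x y → (_ , _) ≈ₑ (x , y)) fa fb ∘ σ-≈ₑ)
    ; ¬adj-σ = ¬adj-σ ∘ proj₁ ∘ D.adj⇒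
    ; vertexC⇒ = λ z∈ → let (z∈G , fz) = vertexC⇒ (DC.vertex⇒ z∈) in D.vertex⇐ z∈G , fz
    ; vertexC⇐ = λ z∈ fz → DC.vertex⇐ (vertexC⇐ (D.vertex⇒ z∈) fz)
    ; adjC⇒ = λ uv → let (uvC , u,v≉ab) = DC.adj⇒ uv ; (uvG , fu , fv) = adjC⇒ uvC in
        D.adj⇐ uvG u,v≉ab , fu , fv
    ; adjC⇐ = λ uv fu fv → let (uvG , u,v≉ab) = D.adj⇒ uv in DC.adj⇐ (adjC⇐ uvG fu fv) u,v≉ab }
    where
    open FixedPart fp
    module D = IsEdgeDeletion del
    module DC = IsEdgeDeletion delC

  FixedPart-deleteVertexPair : ∀ {G C O O′ x} → FixedPart G C → IsVertexDeletion G x O → ¬ Fixed x →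
                               IsVertexDeletion O (σ x) O′ → FixedPart O′ C
  FixedPart-deleteVertexPair {x = x} fp del ¬fx del′ = record
    { wellFormedG = D′.wellFormed ; wellFormedC = wellFormedC
    ; σ-vertex = λ z∈ → let (z∈O , z≢σx) = D′.vertex⇒ z∈ ; (z∈G , z≢x) = D.vertex⇒ z∈O in
        D′.vertex⇐ (D.vertex⇐ (σ-vertex z∈G) (z≢σx ∘ σ-transpose)) (z≢x ∘ σ-injective)
    ; σ-adj = λ uv → let (uvO , u≢σx , v≢σx) = D′.adj⇒ uv ; (uvG , u≢x , v≢x) = D.adj⇒ uvO in
        D′.adj⇐ (D.adj⇐ (σ-adj uvG) (u≢σx ∘ σ-transpose) (v≢σx ∘ σ-transpose))
                (u≢x ∘ σ-injective) (v≢x ∘ σ-injective)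
    ; ¬adj-σ = ¬adj-σ ∘ proj₁ ∘ D.adj⇒ ∘ proj₁ ∘ D′.adj⇒
    ; vertexC⇒ = λ z∈ → let (z∈G , fz) = vertexC⇒ z∈ in
        D′.vertex⇐ (D.vertex⇐ z∈G (fixed≢x fz)) (fixed≢σx fz) , fz
    ; vertexC⇐ = λ z∈ → vertexC⇐ (proj₁ (D.vertex⇒ (proj₁ (D′.vertex⇒ z∈))))
    ; adjC⇒ = λ uv → let (uvG , fu , fv) = adjC⇒ uv in
        D′.adj⇐ (D.adj⇐ uvG (fixed≢x fu) (fixed≢x fv)) (fixed≢σx fu) (fixed≢σx fv) , fu , fv
    ; adjC⇐ = adjC⇐ ∘ proj₁ ∘ D.adj⇒ ∘ proj₁ ∘ D′.adj⇒ }
    where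
    open FixedPart fp
    module D = IsVertexDeletion del
    module D′ = IsVertexDeletion del′
    fixed≢x : ∀ {z} → Fixed z → z ≢ x
    fixed≢x fz refl = ¬fx fz
    fixed≢σx : ∀ {z} → Fixed z → z ≢ σ x
    fixed≢σx fz refl = ¬fx (σ-injective fz)

  FixedPart-deleteEdgePair : ∀ {G C O O′ a b} → FixedPart G C → IsEdgeDeletion G (a , b) O →
                             ¬ (Fixed a × Fixed b) → IsEdgeDeletion O (σ a , σ b) O′ → FixedPart O′ C
  FixedPart-deleteEdgePair fp del ¬fab del′ = record
    { wellFormedG = D′.wellFormed ; wellFormedC = wellFormedC
    ; σ-vertex = D′.vertex⇐ ∘ D.vertex⇐ ∘ σ-vertex ∘ D.vertex⇒ ∘ D′.vertex⇒
    ; σ-adj = λ uv → let (uvO , u,v≉σab) = D′.adj⇒ uv ; (uvG , u,v≉ab) = D.adj⇒ uvO in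
        D′.adj⇐ (D.adj⇐ (σ-adj uvG) (u,v≉σab ∘ σ-≈ₑ)) (u,v≉ab ∘ σ-≈ₑ-injective)
    ; ¬adj-σ = ¬adj-σ ∘ proj₁ ∘ D.adj⇒ ∘ proj₁ ∘ D′.adj⇒
    ; vertexC⇒ = λ z∈ → let (z∈G , fz) = vertexC⇒ z∈ in D′.vertex⇐ (D.vertex⇐ z∈G) , fz
    ; vertexC⇐ = vertexC⇐ ∘ D.vertex⇒ ∘ D′.vertex⇒
    ; adjC⇒ = λ uv → let (uvG , fu , fv) = adjC⇒ uv in
        D′.adj⇐ (D.adj⇐ uvG (¬fab ∘ λ u,v≈ab → ≈ₑ-Fixed u,v≈ab fu fv))
          (λ u,v≈σab → let (fσa , fσb) = ≈ₑ-Fixed u,v≈σab fu fv in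
             ¬fab (σ-injective fσa , σ-injective fσb))
        , fu , fv
    ; adjC⇐ = adjC⇐ ∘ proj₁ ∘ D.adj⇒ ∘ proj₁ ∘ D′.adj⇒ }
    where
    open FixedPart fp
    module D = IsEdgeDeletion del
    module D′ = IsEdgeDeletion del′

  nimAcc-FixedPart : ∀ G → Acc _<_ (size G) → ∀ C → FixedPart G C → nimValue G ≡ nimValue C
  nimAcc-FixedPart G (acc rs) C fp = nimValue≡-from-options G (nimValue C) avoids reaches
    where
    open FixedPart fp
    ih : ∀ {O} → size O < size G → ∀ C′ → FixedPart O C′ → nimValue O ≡ nimValue C′
    ih {O} lt = nimAcc-FixedPart O (rs lt)

    answered : ∀ O → O ∈ options G → ∀ O′ → O′ ∈ options O → FixedPart O′ C → nimValue O ≢ nimValue C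
    answered O O∈ O′ O′∈ fp′ O≡C =
      option-nimValue≢ O O′ O′∈ (trans (ih (<-trans (options-size< O O′∈) (options-size< G O∈)) C fp′) (sym O≡C))

    copied : ∀ O → O ∈ options G → ∀ C′ → C′ ∈ options C → FixedPart O C′ → nimValue O ≢ nimValue C
    copied O O∈ C′ C′∈ fp′ O≡C = option-nimValue≢ C C′ C′∈ (trans (sym (ih (options-size< G O∈) C′ fp′)) O≡C)

    answerVertex : ∀ O → O ∈ options G → ∀ {x} → IsVertexDeletion G x O → ¬ Fixed x → nimValue O ≢ nimValue C
    answerVertex O O∈ del ¬fx =
      let (O′ , O′∈ , del′) = vertexDeletion∈options O D.wellFormed (D.vertex⇐ (σ-vertex D.x∈) ¬fx)
      in answered O O∈ O′ O′∈ (FixedPart-deleteVertexPair fp del ¬fx del′)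
      where module D = IsVertexDeletion del

    answerEdge : ∀ O → O ∈ options G → ∀ {a b} → IsEdgeDeletion G (a , b) O → ¬ (Fixed a × Fixed b) →
                 nimValue O ≢ nimValue C
    answerEdge O O∈ {a} {b} del ¬fab =
      let (O′ , O′∈ , del′) = edgeDeletion∈options O D.wellFormed σab∈O
      in answered O O∈ O′ O′∈ (FixedPart-deleteEdgePair fp del ¬fab del′)
      where
      module D = IsEdgeDeletion del
      σab∈O : Adj O (σ a) (σ b)
      σab∈O = D.adj⇐ (σ-adj D.adjacent) λ
        { (inj₁ fab) → ¬fab fab
        ; (inj₂ (σa≡b , _)) → ¬adj-σ (subst (Adj G a) (sym σa≡b) D.adjacent) }

    avoids : ∀ O → O ∈ options G → nimValue O ≢ nimValue C
    avoids O O∈ with options-deletion G wellFormedG O∈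
    ... | inj₁ (x , del) with σ x ≟ᵥ x
    ...   | yes fx = let (C′ , C′∈ , delC) = vertexDeletion∈options C wellFormedC (vertexC⇐ (IsVertexDeletion.x∈ del) fx)
                     in copied O O∈ C′ C′∈ (FixedPart-deleteFixedVertex fp del delC fx)
    ...   | no ¬fx = answerVertex O O∈ del ¬fx
    avoids O O∈ | inj₂ ((a , b) , del) with σ a ≟ᵥ a | σ b ≟ᵥ b
    ... | yes fa | yes fb = let (C′ , C′∈ , delC) = edgeDeletion∈options C wellFormedC (adjC⇐ (IsEdgeDeletion.adjacent del) fa fb)
                           in copied O O∈ C′ C′∈ (FixedPart-deleteFixedEdge fp del delC fa fb)
    ... | yes _ | no ¬fb = answerEdge O O∈ del (¬fb ∘ proj₂)
    ... | no ¬fa | _ = answerEdge O O∈ del (¬fa ∘ proj₁)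

    reaches : ∀ j → j < nimValue C → Σ Graph λ O → O ∈ options G × nimValue O ≡ j
    reaches j j< with C′ , C′∈ , C′≡j ← <nimValue⇒option C j j< with options-deletion C wellFormedC C′∈
    ... | inj₁ (x , delC) =
      let (x∈G , fx) = vertexC⇒ (IsVertexDeletion.x∈ delC) ; (O , O∈ , del) = vertexDeletion∈options G wellFormedG x∈G
      in O , O∈ , trans (ih (options-size< G O∈) C′ (FixedPart-deleteFixedVertex fp del delC fx)) C′≡j
    ... | inj₂ ((a , b) , delC) =
      let (ab∈G , fa , fb) = adjC⇒ (IsEdgeDeletion.adjacent delC) ; (O , O∈ , del) = edgeDeletion∈options G wellFormedG ab∈G
      in O , O∈ , trans (ih (options-size< G O∈) C′ (FixedPart-deleteFixedEdge fp del delC fa fb)) C′≡j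

  nimValue-FixedPart : ∀ G C → FixedPart G C → nimValue G ≡ nimValue C
  nimValue-FixedPart G = nimAcc-FixedPart G (<-wellFounded (size G))

-- Complete graphs

record IsComplete (n : ℕ) (C : Graph) : Set where
  field
    wellFormed : WellFormed C
    length≡    : length (vertices C) ≡ n
    adjacent   : ∀ {u v} → u ∈ vertices C → v ∈ vertices C → u ≢ v → Adj C u v

IsComplete-deleteVertex : ∀ {m C x O} → IsComplete (suc m) C → IsVertexDeletion C x O → IsComplete m O
IsComplete-deleteVertex K del = record
  { wellFormed = D.wellFormed
  ; length≡ = suc-injective (trans D.length≡ (IsComplete.length≡ K))
  ; adjacent = λ u∈ v∈ u≢v → let (u∈C , u≢x) = D.vertex⇒ u∈ ; (v∈C , v≢x) = D.vertex⇒ v∈ in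
      D.adj⇐ (IsComplete.adjacent K u∈C v∈C u≢v) u≢x v≢x }
  where module D = IsVertexDeletion del

transpose′ : (a b z : Vertex) → Dec (z ≡ a) → Dec (z ≡ b) → Vertex
transpose′ a b z (yes _) _ = b
transpose′ a b z (no _) (yes _) = a
transpose′ a b z (no _) (no _) = z

transpose : Vertex → Vertex → Vertex → Vertex
transpose a b z = transpose′ a b z (z ≟ᵥ a) (z ≟ᵥ b)

data TransposeView (a b z : Vertex) : Vertex → Set where
  at-a      : z ≡ a → TransposeView a b z b
  at-b      : z ≢ a → z ≡ b → TransposeView a b z a
  elsewhere : z ≢ a → z ≢ b → TransposeView a b z z

transpose-view : ∀ a b z → TransposeView a b z (transpose a b z)
transpose-view a b z = view (z ≟ᵥ a) (z ≟ᵥ b)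
  where
  view : ∀ d₁ d₂ → TransposeView a b z (transpose′ a b z d₁ d₂)
  view (yes z≡a) _ = at-a z≡a
  view (no z≢a) (yes z≡b) = at-b z≢a z≡b
  view (no z≢a) (no z≢b) = elsewhere z≢a z≢b

transpose-a : ∀ a b → transpose a b a ≡ b
transpose-a a b with transpose a b a | transpose-view a b a
... | _ | at-a _ = refl
... | _ | at-b a≢a _ = ⊥-elim (a≢a refl)
... | _ | elsewhere a≢a _ = ⊥-elim (a≢a refl)

transpose-b : ∀ {a b} → a ≢ b → transpose a b b ≡ a
transpose-b {a} {b} a≢b with transpose a b b | transpose-view a b b
... | _ | at-a b≡a = ⊥-elim (a≢b (sym b≡a))
... | _ | at-b _ _ = refl
... | _ | elsewhere _ b≢b = ⊥-elim (b≢b refl)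

transpose-elsewhere : ∀ {a b z} → z ≢ a → z ≢ b → transpose a b z ≡ z
transpose-elsewhere {a} {b} {z} z≢a z≢b with transpose a b z | transpose-view a b z
... | _ | at-a z≡a = ⊥-elim (z≢a z≡a)
... | _ | at-b _ z≡b = ⊥-elim (z≢b z≡b)
... | _ | elsewhere _ _ = refl

transpose-involutive : ∀ {a b} → a ≢ b → ∀ z → transpose a b (transpose a b z) ≡ z
transpose-involutive {a} {b} a≢b z with transpose a b z | transpose-view a b z
... | _ | at-a refl = transpose-b a≢b
... | _ | at-b _ refl = transpose-a a b
... | _ | elsewhere z≢a z≢b = transpose-elsewhere z≢a z≢b

module TransposeEnds {a b : Vertex} (a≢b : a ≢ b) where

  open Mirror (transpose a b) (transpose-involutive a≢b)

  σ : Vertex → Vertex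
  σ = transpose a b

  σ-∈ : ∀ {vs z} → a ∈ vs → b ∈ vs → z ∈ vs → σ z ∈ vs
  σ-∈ {z = z} a∈ b∈ z∈ with σ z | transpose-view a b z
  ... | _ | at-a _ = b∈
  ... | _ | at-b _ _ = a∈
  ... | _ | elsewhere _ _ = z∈

  Fixed⇒≢a : ∀ {z} → Fixed z → z ≢ a
  Fixed⇒≢a fz refl = a≢b (trans (sym fz) (transpose-a a b))

  Fixed⇒≢b : ∀ {z} → Fixed z → z ≢ b
  Fixed⇒≢b fz refl = a≢b (trans (sym (transpose-b a≢b)) fz)

  ¬adj-σ-without-ab : ∀ {G O} → WellFormed G → IsEdgeDeletion G (a , b) O → ∀ {u} → ¬ Adj O u (σ u)
  ¬adj-σ-without-ab wf del {u} uσu with σ u | transpose-view a b u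
  ... | _ | at-a refl = proj₂ (IsEdgeDeletion.adj⇒ del uσu) ≈ₑ-refl
  ... | _ | at-b _ refl = proj₂ (IsEdgeDeletion.adj⇒ del uσu) (inj₂ (refl , refl))
  ... | _ | elsewhere _ _ = proj₂ (proj₂ (Adj⇒ends wf (proj₁ (IsEdgeDeletion.adj⇒ del uσu)))) refl

  -- The transposition of the ends of the deleted edge fixes exactly the other m vertices.
  deleteEdge-FixedPart : ∀ {m C O} → IsComplete (suc (suc m)) C → IsEdgeDeletion C (a , b) O →
                         Σ Graph λ O₂ → IsComplete m O₂ × FixedPart O O₂
  deleteEdge-FixedPart {m} {C} {O} K del = O₂ , K₂ , fp
    where
    module D = IsEdgeDeletion del
    wfC = IsComplete.wellFormed K
    a∈ = proj₁ (Adj⇒ends wfC D.adjacent)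
    b∈ = proj₁ (proj₂ (Adj⇒ends wfC D.adjacent))
    delA = proj₂ (proj₂ (vertexDeletion∈options C wfC a∈))
    module DA = IsVertexDeletion delA
    delB = proj₂ (proj₂ (vertexDeletion∈options _ DA.wellFormed (DA.vertex⇐ b∈ (a≢b ∘ sym))))
    module DB = IsVertexDeletion delB
    O₂ = proj₁ (vertexDeletion∈options _ DA.wellFormed (DA.vertex⇐ b∈ (a≢b ∘ sym)))
    K₂ : IsComplete m O₂
    K₂ = IsComplete-deleteVertex (IsComplete-deleteVertex K delA) delB
    ≢⇒≉ab : ∀ {u v} → u ≢ a → u ≢ b → ¬ (u , v) ≈ₑ (a , b)
    ≢⇒≉ab u≢a u≢b (inj₁ (u≡a , _)) = u≢a u≡a
    ≢⇒≉ab u≢a u≢b (inj₂ (u≡b , _)) = u≢b u≡b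
    σ≉ab : ∀ {u v} → ¬ (u , v) ≈ₑ (a , b) → ¬ (σ u , σ v) ≈ₑ (a , b)
    σ≉ab {u} {v} u,v≉ab σuv≈ab = u,v≉ab (≈ₑ-trans
      (subst₂ (λ x y → (u , v) ≈ₑ (x , y)) (transpose-a a b) (transpose-b a≢b) (σ-≈ₑ σuv≈ab))
      (inj₂ (refl , refl)))
    fp : FixedPart O O₂
    fp = record
      { wellFormedG = D.wellFormed ; wellFormedC = IsComplete.wellFormed K₂
      ; σ-vertex = D.vertex⇐ ∘ σ-∈ a∈ b∈ ∘ D.vertex⇒
      ; σ-adj = λ uv → let (uvC , u,v≉ab) = D.adj⇒ uv ; (u∈ , v∈ , u≢v) = Adj⇒ends wfC uvC in
          D.adj⇐ (IsComplete.adjacent K (σ-∈ a∈ b∈ u∈) (σ-∈ a∈ b∈ v∈) (u≢v ∘ σ-injective)) (σ≉ab u,v≉ab)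
      ; ¬adj-σ = ¬adj-σ-without-ab wfC del
      ; vertexC⇒ = λ z∈ → let (z∈A , z≢b) = DB.vertex⇒ z∈ ; (z∈C , z≢a) = DA.vertex⇒ z∈A in
          D.vertex⇐ z∈C , transpose-elsewhere z≢a z≢b
      ; vertexC⇐ = λ z∈ fz → DB.vertex⇐ (DA.vertex⇐ (D.vertex⇒ z∈) (Fixed⇒≢a fz)) (Fixed⇒≢b fz)
      ; adjC⇒ = λ uv → let (uvA , u≢b , v≢b) = DB.adj⇒ uv ; (uvC , u≢a , v≢a) = DA.adj⇒ uvA in
          D.adj⇐ uvC (≢⇒≉ab u≢a u≢b) , transpose-elsewhere u≢a u≢b , transpose-elsewhere v≢a v≢b
      ; adjC⇐ = λ uv fu fv → DB.adj⇐ (DA.adj⇐ (proj₁ (D.adj⇒ uv)) (Fixed⇒≢a fu) (Fixed⇒≢a fv))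
                                      (Fixed⇒≢b fu) (Fixed⇒≢b fv) }

[3+n]%3≡n%3 : ∀ n → (3 + n) % 3 ≡ n % 3
[3+n]%3≡n%3 n = trans (cong (_% 3) (+-comm 3 n)) ([m+n]%n≡m%n n 3)

[2+n]%3≢[1+n]%3 : ∀ n → (2 + n) % 3 ≢ (1 + n) % 3
[2+n]%3≢[1+n]%3 0 ()
[2+n]%3≢[1+n]%3 1 ()
[2+n]%3≢[1+n]%3 2 ()
[2+n]%3≢[1+n]%3 (suc (suc (suc n))) rewrite [3+n]%3≡n%3 (2 + n) | [3+n]%3≡n%3 (1 + n) = [2+n]%3≢[1+n]%3 n

[2+n]%3≢n%3 : ∀ n → (2 + n) % 3 ≢ n % 3
[2+n]%3≢n%3 0 ()
[2+n]%3≢n%3 1 ()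
[2+n]%3≢n%3 2 ()
[2+n]%3≢n%3 (suc (suc (suc n))) rewrite [3+n]%3≡n%3 (2 + n) | [3+n]%3≡n%3 n = [2+n]%3≢n%3 n

<[2+n]%3 : ∀ n j → j < (2 + n) % 3 → j ≡ (1 + n) % 3 ⊎ j ≡ n % 3
<[2+n]%3 0 0 _ = inj₂ refl
<[2+n]%3 0 1 _ = inj₁ refl
<[2+n]%3 0 (suc (suc j)) (s≤s (s≤s ()))
<[2+n]%3 1 j ()
<[2+n]%3 2 0 _ = inj₁ refl
<[2+n]%3 2 (suc j) (s≤s ())
<[2+n]%3 (suc (suc (suc n))) j j< rewrite [3+n]%3≡n%3 (2 + n) | [3+n]%3≡n%3 (1 + n) | [3+n]%3≡n%3 n = <[2+n]%3 n j j<

module _ {n C} (K : IsComplete n C) where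
  open IsComplete K

  IsComplete-0-∉ : n ≡ 0 → ∀ {x} → x ∉ vertices C
  IsComplete-0-∉ refl x∈ with vertices C | length≡
  IsComplete-0-∉ refl () | [] | _

  IsComplete-1-≡ : n ≡ 1 → ∀ {x y} → x ∈ vertices C → y ∈ vertices C → x ≡ y
  IsComplete-1-≡ refl x∈ y∈ with vertices C | length≡
  IsComplete-1-≡ refl (here refl) (here refl) | _ ∷ [] | _ = refl

  IsComplete-vertex : ∀ {m} → n ≡ suc m → Σ Vertex (_∈ vertices C)
  IsComplete-vertex refl with vertices C | length≡
  ... | x ∷ _ | _ = x , here refl

  IsComplete-edge : ∀ {m} → n ≡ suc (suc m) → Σ Vertex λ u → Σ Vertex λ v → Adj C u v
  IsComplete-edge refl with vertices C | length≡ | WellFormed.distinctVertices wellFormed | adjacent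
  ... | u ∷ v ∷ _ | _ | (u≢v All.∷ _) ∷ _ | adj = u , v , adj (here refl) (there (here refl)) u≢v

nimValue-complete₀ : ∀ {C} → IsComplete 0 C → nimValue C ≡ 0
nimValue-complete₀ {C} K = nimValue≡-from-options C 0 noOption (λ _ ())
  where
  noOption : ∀ O → O ∈ options C → nimValue O ≢ 0
  noOption O O∈ with options-deletion C (IsComplete.wellFormed K) O∈
  ... | inj₁ (_ , del) = ⊥-elim (IsComplete-0-∉ K refl (IsVertexDeletion.x∈ del))
  ... | inj₂ (_ , del) = ⊥-elim (IsComplete-0-∉ K refl (proj₁ (Adj⇒ends (IsComplete.wellFormed K) (IsEdgeDeletion.adjacent del))))

nimValue-complete₁ : ∀ {C} → IsComplete 1 C → nimValue C ≡ 1
nimValue-complete₁ {C} K = nimValue≡-from-options C 1 avoids reaches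
  where
  open IsComplete K
  avoids : ∀ O → O ∈ options C → nimValue O ≢ 1
  avoids O O∈ with options-deletion C wellFormed O∈
  ... | inj₁ (_ , del) = λ O≡1 → 0≢1+n (trans (sym (nimValue-complete₀ (IsComplete-deleteVertex K del))) O≡1)
  ... | inj₂ (_ , del) = let (a∈ , b∈ , a≢b) = Adj⇒ends wellFormed (IsEdgeDeletion.adjacent del) in
                         ⊥-elim (a≢b (IsComplete-1-≡ K refl a∈ b∈))
  reaches : ∀ j → j < 1 → Σ Graph λ O → O ∈ options C × nimValue O ≡ j
  reaches zero _ = let (O , O∈ , del) = vertexDeletion∈options C wellFormed (proj₂ (IsComplete-vertex K refl)) in
                   O , O∈ , nimValue-complete₀ (IsComplete-deleteVertex K del)
  reaches (suc j) (s≤s ())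

nimValue-complete₂₊ : ∀ m {C} → IsComplete (2 + m) C →
                      (∀ {O} → IsComplete (1 + m) O → nimValue O ≡ (1 + m) % 3) →
                      (∀ {O} → IsComplete m O → nimValue O ≡ m % 3) →
                      nimValue C ≡ (2 + m) % 3
nimValue-complete₂₊ m {C} K ih₁ ih₀ = nimValue≡-from-options C ((2 + m) % 3) avoids reaches
  where
  open IsComplete K
  deleteEdge-nimValue : ∀ {O a b} → IsEdgeDeletion C (a , b) O → nimValue O ≡ m % 3
  deleteEdge-nimValue {O} {a} {b} del =
    let a≢b = proj₂ (proj₂ (Adj⇒ends wellFormed (IsEdgeDeletion.adjacent del)))
        (O₂ , K₂ , fp) = TransposeEnds.deleteEdge-FixedPart a≢b K del
    in trans (Mirror.nimValue-FixedPart (transpose a b) (transpose-involutive a≢b) O O₂ fp) (ih₀ K₂)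
  avoids : ∀ O → O ∈ options C → nimValue O ≢ (2 + m) % 3
  avoids O O∈ with options-deletion C wellFormed O∈
  ... | inj₁ (_ , del) = λ O≡ → [2+n]%3≢[1+n]%3 m (trans (sym O≡) (ih₁ (IsComplete-deleteVertex K del)))
  ... | inj₂ (_ , del) = λ O≡ → [2+n]%3≢n%3 m (trans (sym O≡) (deleteEdge-nimValue del))
  reaches : ∀ j → j < (2 + m) % 3 → Σ Graph λ O → O ∈ options C × nimValue O ≡ j
  reaches j j< with <[2+n]%3 m j j<
  ... | inj₁ refl = let (O , O∈ , del) = vertexDeletion∈options C wellFormed (proj₂ (IsComplete-vertex K refl)) in
                    O , O∈ , ih₁ (IsComplete-deleteVertex K del)
  ... | inj₂ refl = let (u , v , uv) = IsComplete-edge K refl ; (O , O∈ , del) = edgeDeletion∈options C wellFormed uv in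
                    O , O∈ , deleteEdge-nimValue del

nimValue-complete : ∀ n {C} → IsComplete n C → nimValue C ≡ n % 3
nimValue-complete 0 = nimValue-complete₀
nimValue-complete 1 = nimValue-complete₁
nimValue-complete (suc (suc m)) K = nimValue-complete₂₊ m K (nimValue-complete (suc m)) (nimValue-complete m)

∈orderedPairs⇒∈ : ∀ {xs : List Vertex} {u v} → (u , v) ∈ orderedPairs xs → u ∈ xs × v ∈ xs
∈orderedPairs⇒∈ {x ∷ xs} p with ∈-++⁻ (map (x ,_) xs) p
... | inj₁ q with _ , y∈ , refl ← ∈-map⁻ (x ,_) q = here refl , there y∈
... | inj₂ q = let (u∈ , v∈) = ∈orderedPairs⇒∈ q in there u∈ , there v∈

∈orderedPairs⇒≢ : ∀ {xs : List Vertex} {u v} → AllPairs _≢_ xs → (u , v) ∈ orderedPairs xs → u ≢ v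
∈orderedPairs⇒≢ {x ∷ xs} (x≢ ∷ distinct) p with ∈-++⁻ (map (x ,_) xs) p
... | inj₁ q with _ , y∈ , refl ← ∈-map⁻ (x ,_) q = All.lookup x≢ y∈
... | inj₂ q = ∈orderedPairs⇒≢ distinct q

∈orderedPairs⁺ : ∀ {xs : List Vertex} {u v} → u ∈ xs → v ∈ xs → u ≢ v →
                 (u , v) ∈ orderedPairs xs ⊎ (v , u) ∈ orderedPairs xs
∈orderedPairs⁺ {x ∷ xs} (here refl) (here refl) u≢v = ⊥-elim (u≢v refl)
∈orderedPairs⁺ {x ∷ xs} (here refl) (there v∈) _ = inj₁ (∈-++⁺ˡ (∈-map⁺ (x ,_) v∈))
∈orderedPairs⁺ {x ∷ xs} (there u∈) (here refl) _ = inj₂ (∈-++⁺ˡ (∈-map⁺ (x ,_) u∈))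
∈orderedPairs⁺ {x ∷ xs} (there u∈) (there v∈) u≢v =
  map-⊎ (∈-++⁺ʳ (map (x ,_) xs)) (∈-++⁺ʳ (map (x ,_) xs)) (∈orderedPairs⁺ u∈ v∈ u≢v)

orderedPairs-distinct : ∀ {xs : List Vertex} → AllPairs _≢_ xs → AllPairs (λ e f → ¬ e ≈ₑ f) (orderedPairs xs)
orderedPairs-distinct {[]} [] = []
orderedPairs-distinct {x ∷ xs} (x≢ ∷ distinct) =
  AllPairs.++⁺ (fromX x∉ distinct) (orderedPairs-distinct distinct)
               (All.tabulate λ e∈ → All.tabulate λ f∈ → fromX≉rest e∈ f∈)
  where
  x∉ : x ∉ xs
  x∉ x∈ = All.lookup x≢ x∈ refl
  fromX : ∀ {ys} → x ∉ ys → AllPairs _≢_ ys → AllPairs (λ e f → ¬ e ≈ₑ f) (map (x ,_) ys)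
  fromX {[]} _ [] = []
  fromX {y ∷ ys} x∉ (y≢ ∷ distinct) = All.tabulate y≉ ∷ fromX (x∉ ∘ there) distinct
    where
    y≉ : ∀ {f} → f ∈ map (x ,_) ys → ¬ (x , y) ≈ₑ f
    y≉ f∈ x,y≈f with _ , z∈ , refl ← ∈-map⁻ (x ,_) f∈ with x,y≈f
    ... | inj₁ (_ , refl) = All.lookup y≢ z∈ refl
    ... | inj₂ (refl , _) = x∉ (there z∈)
  fromX≉rest : ∀ {e f} → e ∈ map (x ,_) xs → f ∈ orderedPairs xs → ¬ e ≈ₑ f
  fromX≉rest e∈ f∈ e≈f with _ , _ , refl ← ∈-map⁻ (x ,_) e∈ with u∈ , v∈ ← ∈orderedPairs⇒∈ {xs} f∈ with e≈f
  ... | inj₁ (refl , _) = x∉ u∈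
  ... | inj₂ (refl , _) = x∉ v∈

orderedPairs⇒Adj : ∀ {xs vs : List Vertex} {u v} → (u , v) ∈ orderedPairs xs ⊎ (v , u) ∈ orderedPairs xs →
                   Adj (graph vs (orderedPairs xs)) u v
orderedPairs⇒Adj (inj₁ uv∈) = _ , uv∈ , ≈ₑ-refl
orderedPairs⇒Adj (inj₂ vu∈) = _ , vu∈ , inj₂ (refl , refl)

++-distinct-blocks : ∀ {xs ys : List Vertex} {i} → AllPairs _≢_ xs → AllPairs _≢_ ys →
                     (∀ {z} → z ∈ xs → proj₁ z ≡ i) → (∀ {z} → z ∈ ys → i < proj₁ z) → AllPairs _≢_ (xs ++ ys)
++-distinct-blocks distinctXs distinctYs inBlock afterBlock =
  AllPairs.++⁺ distinctXs distinctYs (All.tabulate λ z∈ → All.tabulate λ w∈ z≡w →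
    <-irrefl (sym (inBlock z∈)) (subst (λ w → _ < proj₁ w) (sym z≡w) (afterBlock w∈)))

-- Complete multipartite graphs

partSize : List ℕ → ℕ → ℕ
partSize [] k = 0
partSize (a ∷ as) zero = a
partSize (a ∷ as) (suc k) = partSize as k

∈partVertices⇒ : ∀ as i {i′ j} → (i′ , j) ∈ partVertices i as → Σ ℕ λ k → i′ ≡ i + k × j < partSize as k
∈partVertices⇒ (a ∷ as) i p with ∈-++⁻ (map (i ,_) (upTo a)) p
... | inj₁ q with _ , j∈ , refl ← ∈-map⁻ (i ,_) q = 0 , sym (+-identityʳ i) , ∈-upTo⁻ j∈
... | inj₂ q with k , refl , j< ← ∈partVertices⇒ as (suc i) q = suc k , sym (+-suc i k) , j<

∈partVertices⁺ : ∀ as i k {j} → j < partSize as k → (i + k , j) ∈ partVertices i as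
∈partVertices⁺ (a ∷ as) i zero j< rewrite +-identityʳ i = ∈-++⁺ˡ (∈-map⁺ (i ,_) (∈-upTo⁺ j<))
∈partVertices⁺ (a ∷ as) i (suc k) j< rewrite +-suc i k = ∈-++⁺ʳ (map (i ,_) (upTo a)) (∈partVertices⁺ as (suc i) k j<)

partVertices-distinct : ∀ as i → AllPairs _≢_ (partVertices i as)
partVertices-distinct [] i = []
partVertices-distinct (a ∷ as) i = ++-distinct-blocks
  (Unique.map⁺ (cong proj₂) (Unique.upTo⁺ a)) (partVertices-distinct as (suc i))
  (λ z∈ → let (_ , _ , z≡) = ∈-map⁻ (i ,_) z∈ in cong proj₁ z≡)
  (λ z∈ → let (k , i′≡ , _) = ∈partVertices⇒ as (suc i) z∈ in subst (i <_) (sym i′≡) (m≤m+n (suc i) k))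

reflect : ℕ → ℕ → ℕ
reflect zero j = j
reflect (suc b) j with j ≤? b
... | yes _ = b ∸ j
... | no _ = j

reflect-≤ : ∀ {b j} → j ≤ b → reflect (suc b) j ≡ b ∸ j
reflect-≤ {b} {j} j≤b with j ≤? b
... | yes _ = refl
... | no j≰b = ⊥-elim (j≰b j≤b)

reflect-≰ : ∀ {b j} → ¬ j ≤ b → reflect (suc b) j ≡ j
reflect-≰ {b} {j} j≰b with j ≤? b
... | yes j≤b = ⊥-elim (j≰b j≤b)
... | no _ = refl

reflect-involutive : ∀ a j → reflect a (reflect a j) ≡ j
reflect-involutive zero j = refl
reflect-involutive (suc b) j with j ≤? b
... | yes j≤b = trans (reflect-≤ (m∸n≤m b j)) (m∸[m∸n]≡n j≤b)
... | no j≰b = reflect-≰ j≰b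

reflect-< : ∀ {a j} → j < a → reflect a j < a
reflect-< {suc b} {j} (s≤s j≤b) = s≤s (subst (_≤ b) (sym (reflect-≤ j≤b)) (m∸n≤m b j))

reflect-fixed⇒ : ∀ {b j} → j < suc b → reflect (suc b) j ≡ j → j + j ≡ b
reflect-fixed⇒ {b} {j} (s≤s j≤b) fixed = begin
  j + j       ≡⟨ cong (_+ j) (trans (sym fixed) (reflect-≤ j≤b)) ⟩
  b ∸ j + j   ≡⟨ m∸n+n≡m j≤b ⟩
  b           ∎
  where open ≡-Reasoning

reflect-fixed⇐ : ∀ j → reflect (suc (j + j)) j ≡ j
reflect-fixed⇐ j = trans (reflect-≤ (m≤m+n j j)) (m+n∸n≡m j j)

exactHalf : ℕ → Maybe ℕ
exactHalf zero = just zero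
exactHalf (suc zero) = nothing
exactHalf (suc (suc b)) = Maybe.map suc (exactHalf b)

exactHalf-just⇒ : ∀ b {h} → exactHalf b ≡ just h → h + h ≡ b
exactHalf-just⇒ zero refl = refl
exactHalf-just⇒ (suc (suc b)) eq with exactHalf b in eq′
exactHalf-just⇒ (suc (suc b)) refl | just h = cong suc (trans (+-suc h h) (cong suc (exactHalf-just⇒ b eq′)))

exactHalf-double : ∀ h → exactHalf (h + h) ≡ just h
exactHalf-double zero = refl
exactHalf-double (suc h) rewrite +-suc h h | exactHalf-double h = refl

exactHalf-just⇒odd : ∀ b {h} → exactHalf b ≡ just h → suc b % 2 ≡ 1
exactHalf-just⇒odd zero _ = refl
exactHalf-just⇒odd (suc (suc b)) eq with exactHalf b in eq′
exactHalf-just⇒odd (suc (suc b)) refl | just _ = exactHalf-just⇒odd b eq′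

exactHalf-nothing⇒even : ∀ b → exactHalf b ≡ nothing → suc b % 2 ≢ 1
exactHalf-nothing⇒even (suc zero) _ ()
exactHalf-nothing⇒even (suc (suc b)) eq with exactHalf b in eq′
exactHalf-nothing⇒even (suc (suc b)) refl | nothing = exactHalf-nothing⇒even b eq′

centre : ℕ → ℕ → List Vertex
centre i zero = []
centre i (suc b) with exactHalf b
... | just h = (i , h) ∷ []
... | nothing = []

centres : ℕ → List ℕ → List Vertex
centres i [] = []
centres i (a ∷ as) = centre i a ++ centres (suc i) as

∈centre⇒ : ∀ i a {i′ j} → (i′ , j) ∈ centre i a → i′ ≡ i × j < a × reflect a j ≡ j
∈centre⇒ i (suc b) p with exactHalf b in eq
∈centre⇒ i (suc b) (here refl) | just h =
  refl , s≤s (subst (h ≤_) (exactHalf-just⇒ b eq) (m≤m+n h h)) , subst (λ b → reflect (suc b) h ≡ h) (exactHalf-just⇒ b eq) (reflect-fixed⇐ h)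

∈centre⁺ : ∀ i a {j} → j < a → reflect a j ≡ j → (i , j) ∈ centre i a
∈centre⁺ i (suc b) {j} j< fixed rewrite sym (reflect-fixed⇒ j< fixed) | exactHalf-double j = here refl

centre-distinct : ∀ i a → AllPairs _≢_ (centre i a)
centre-distinct i zero = []
centre-distinct i (suc b) with exactHalf b
... | just _ = All.[] ∷ []
... | nothing = []

∈centres⇒ : ∀ as i {i′ j} → (i′ , j) ∈ centres i as →
            Σ ℕ λ k → i′ ≡ i + k × j < partSize as k × reflect (partSize as k) j ≡ j
∈centres⇒ (a ∷ as) i p with ∈-++⁻ (centre i a) p
... | inj₁ q = let (i′≡ , j< , fixed) = ∈centre⇒ i a q in 0 , trans i′≡ (sym (+-identityʳ i)) , j< , fixed
... | inj₂ q with k , refl , j< , fixed ← ∈centres⇒ as (suc i) q = suc k , sym (+-suc i k) , j< , fixed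

∈centres⁺ : ∀ as i k {j} → j < partSize as k → reflect (partSize as k) j ≡ j → (i + k , j) ∈ centres i as
∈centres⁺ (a ∷ as) i zero j< fixed rewrite +-identityʳ i = ∈-++⁺ˡ (∈centre⁺ i a j< fixed)
∈centres⁺ (a ∷ as) i (suc k) j< fixed rewrite +-suc i k = ∈-++⁺ʳ (centre i a) (∈centres⁺ as (suc i) k j< fixed)

centres-distinct : ∀ as i → AllPairs _≢_ (centres i as)
centres-distinct [] i = []
centres-distinct (a ∷ as) i = ++-distinct-blocks (centre-distinct i a) (centres-distinct as (suc i))
  (λ z∈ → proj₁ (∈centre⇒ i a z∈))
  (λ z∈ → let (k , i′≡ , _) = ∈centres⇒ as (suc i) z∈ in subst (i <_) (sym i′≡) (m≤m+n (suc i) k))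

length-centres : ∀ as i → All (0 <_) as → length (centres i as) ≡ numOdd as
length-centres [] i _ = refl
length-centres (suc b ∷ as) i (_ All.∷ positive) with exactHalf b in eq
... | just _ = trans (cong suc (length-centres as (suc i) positive))
                     (cong length (sym (filter-accept (λ a → a % 2 ≟ 1) {x = suc b} {xs = as} (exactHalf-just⇒odd b eq))))
... | nothing = trans (length-centres as (suc i) positive)
                      (cong length (sym (filter-reject (λ a → a % 2 ≟ 1) {x = suc b} {xs = as} (exactHalf-nothing⇒even b eq))))

reflectParts : List ℕ → Vertex → Vertex
reflectParts as (i , j) = i , reflect (partSize as i) j

reflectParts-involutive : ∀ as z → reflectParts as (reflectParts as z) ≡ z
reflectParts-involutive as (i , j) = cong (i ,_) (reflect-involutive (partSize as i) j)

centreGraph : List ℕ → Graph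
centreGraph as = graph (centres 0 as) (orderedPairs (centres 0 as))

module Multipartite (as : List ℕ) where

  open Mirror (reflectParts as) (reflectParts-involutive as)

  vs = partVertices 0 as
  cs = centres 0 as
  differentParts? : (e : Edge) → Dec (¬ proj₁ (proj₁ e) ≡ proj₁ (proj₂ e))
  differentParts? e = ¬? (proj₁ (proj₁ e) ≟ proj₁ (proj₂ e))

  ∈vs⇒ : ∀ {k j} → (k , j) ∈ vs → j < partSize as k
  ∈vs⇒ p with _ , refl , j< ← ∈partVertices⇒ as 0 p = j<

  ∈cs⇒ : ∀ {k j} → (k , j) ∈ cs → j < partSize as k × reflect (partSize as k) j ≡ j
  ∈cs⇒ p with _ , refl , j< , fixed ← ∈centres⇒ as 0 p = j< , fixed

  wellFormed-multipartite : WellFormed (completeMultipartite as)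
  wellFormed-multipartite = record
    { distinctVertices = partVertices-distinct as 0
    ; distinctEdges = AllPairs.filter⁺ differentParts? (orderedPairs-distinct (partVertices-distinct as 0))
    ; edgeEnds = λ e∈ → let e∈′ = proj₁ (∈-filter⁻ differentParts? {xs = orderedPairs vs} e∈)
                            (u∈ , v∈) = ∈orderedPairs⇒∈ {vs} e∈′ in
        u∈ , v∈ , ∈orderedPairs⇒≢ (partVertices-distinct as 0) e∈′ }

  Adj-multipartite⇒ : ∀ {u v} → Adj (completeMultipartite as) u v → u ∈ vs × v ∈ vs × proj₁ u ≢ proj₁ v
  Adj-multipartite⇒ (_ , e∈ , _) with ∈-filter⁻ differentParts? {xs = orderedPairs vs} e∈
  Adj-multipartite⇒ (_ , _ , inj₁ (refl , refl)) | e∈′ , u≢v =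
    let (u∈ , v∈) = ∈orderedPairs⇒∈ {vs} e∈′ in u∈ , v∈ , u≢v
  Adj-multipartite⇒ (_ , _ , inj₂ (refl , refl)) | e∈′ , v≢u =
    let (v∈ , u∈) = ∈orderedPairs⇒∈ {vs} e∈′ in u∈ , v∈ , ≢-sym v≢u

  Adj-multipartite⁺ : ∀ {u v} → u ∈ vs → v ∈ vs → proj₁ u ≢ proj₁ v → Adj (completeMultipartite as) u v
  Adj-multipartite⁺ u∈ v∈ u≢v with ∈orderedPairs⁺ {vs} u∈ v∈ (u≢v ∘ cong proj₁)
  ... | inj₁ uv∈ = _ , ∈-filter⁺ differentParts? uv∈ u≢v , ≈ₑ-refl
  ... | inj₂ vu∈ = _ , ∈-filter⁺ differentParts? vu∈ (≢-sym u≢v) , inj₂ (refl , refl)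

  wellFormed-centreGraph : WellFormed (centreGraph as)
  wellFormed-centreGraph = record
    { distinctVertices = centres-distinct as 0
    ; distinctEdges = orderedPairs-distinct (centres-distinct as 0)
    ; edgeEnds = λ e∈ → let (u∈ , v∈) = ∈orderedPairs⇒∈ {cs} e∈ in
        u∈ , v∈ , ∈orderedPairs⇒≢ (centres-distinct as 0) e∈ }

  isComplete-centreGraph : All (0 <_) as → IsComplete (numOdd as) (centreGraph as)
  isComplete-centreGraph positive = record
    { wellFormed = wellFormed-centreGraph
    ; length≡ = length-centres as 0 positive
    ; adjacent = λ u∈ v∈ u≢v → orderedPairs⇒Adj {cs} {cs} (∈orderedPairs⁺ u∈ v∈ u≢v) }

  centres-differentParts : ∀ {u v} → u ∈ cs → v ∈ cs → u ≢ v → proj₁ u ≢ proj₁ v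
  centres-differentParts {k , j} {_ , j′} u∈ v∈ u≢v refl =
    let (j< , fixed) = ∈cs⇒ u∈ ; (j′< , fixed′) = ∈cs⇒ v∈ in
    u≢v (cong (k ,_) (double-injective (centre-double j< fixed) (centre-double j′< fixed′)))
    where
    centre-double : ∀ {a j} → j < a → reflect a j ≡ j → j + j ≡ a ∸ 1
    centre-double {suc b} = reflect-fixed⇒
    double-injective : ∀ {m n c} → m + m ≡ c → n + n ≡ c → m ≡ n
    double-injective {m} {n} refl n+n≡ =
      trans (n≡⌊n+n/2⌋ m) (trans (cong ⌊_/2⌋ (sym n+n≡)) (sym (n≡⌊n+n/2⌋ n)))

  reflectParts-∈ : ∀ {z} → z ∈ vs → reflectParts as z ∈ vs
  reflectParts-∈ {k , j} z∈ = ∈partVertices⁺ as 0 k (reflect-< (∈vs⇒ z∈))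

  centre⇒fixed : ∀ {z} → z ∈ cs → z ∈ vs × Fixed z
  centre⇒fixed {k , j} z∈ = let (j< , fixed) = ∈cs⇒ z∈ in ∈partVertices⁺ as 0 k j< , cong (k ,_) fixed

  fixed⇒centre : ∀ {z} → z ∈ vs → Fixed z → z ∈ cs
  fixed⇒centre {k , j} z∈ fixed = ∈centres⁺ as 0 k (∈vs⇒ z∈) (cong proj₂ fixed)

  fixedPart-multipartite : FixedPart (completeMultipartite as) (centreGraph as)
  fixedPart-multipartite = record
    { wellFormedG = wellFormed-multipartite ; wellFormedC = wellFormed-centreGraph
    ; σ-vertex = reflectParts-∈
    ; σ-adj = λ uv → let (u∈ , v∈ , parts≢) = Adj-multipartite⇒ uv in
        Adj-multipartite⁺ (reflectParts-∈ u∈) (reflectParts-∈ v∈) parts≢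
    ; ¬adj-σ = λ uv → proj₂ (proj₂ (Adj-multipartite⇒ uv)) refl
    ; vertexC⇒ = centre⇒fixed
    ; vertexC⇐ = fixed⇒centre
    ; adjC⇒ = λ uv → let (u∈ , v∈ , u≢v) = Adj⇒ends wellFormed-centreGraph uv
                         (u∈G , fu) = centre⇒fixed u∈ ; (v∈G , fv) = centre⇒fixed v∈ in
        Adj-multipartite⁺ u∈G v∈G (centres-differentParts u∈ v∈ u≢v) , fu , fv
    ; adjC⇐ = λ uv fu fv → let (u∈ , v∈ , parts≢) = Adj-multipartite⇒ uv in
        orderedPairs⇒Adj {cs} {cs} (∈orderedPairs⁺ (fixed⇒centre u∈ fu) (fixed⇒centre v∈ fv) (parts≢ ∘ cong proj₁)) }

theorem2 : (as : List ℕ) → All (λ a → 0 < a) as →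
           nimValue (completeMultipartite as) ≡ numOdd as % 3
theorem2 as positive = begin
  nimValue (completeMultipartite as) ≡⟨ Mirror.nimValue-FixedPart (reflectParts as) (reflectParts-involutive as)
                                          (completeMultipartite as) (centreGraph as) fixedPart-multipartite ⟩
  nimValue (centreGraph as)          ≡⟨ nimValue-complete (numOdd as) (isComplete-centreGraph positive) ⟩
  numOdd as % 3                      ∎
  where
  open ≡-Reasoning
  open Multipartite as
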